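{- Let $\Pi$ be the map on $\mathbb{N}=\{1,2,3,\dots\}$ produced by the following procedure. At step $1$ set $\Pi(1)=1$. For $m=2,3,4,\dots$ in turn, at step $m$: if $\Pi(m-\lfloor m/2\rfloor)$ has not been assigned at an earlier step, set $\Pi(m-\lfloor m/2\rfloor)=m$; otherwise set $\Pi(m+\lfloor m/2\rfloor)=m$. Then $\Pi(3n)=2n$ for all $n\ge 1$. -}

module Defs where

open import Data.Nat using (ℕ; zero; suc; _+_; _∸_; _/_; _≟_)
open import Data.Maybe using (Maybe; just; nothing; is-just)
open import Data.Bool using (if_then_else_)
open import Relation.Nullary using (yes; no)

PartialMap : Set
PartialMap = ℕ → Maybe ℕ

-- set position p to value v (overwriting, as "set" reads literally)
assign : PartialMap → ℕ → ℕ → PartialMap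
assign f p v q with q ≟ p
... | yes _ = just v
... | no  _ = f q

stepPos : PartialMap → ℕ → ℕ
stepPos f k =
  if is-just (f (k ∸ k / 2)) then k + k / 2 else k ∸ k / 2

-- state m = the partial map after steps 1,…,m have been performed
state : ℕ → PartialMap
state zero = λ _ → nothing
state (suc zero) = assign (state zero) 1 1
state (suc (suc m)) =
  assign (state (suc m)) (stepPos (state (suc m)) (suc (suc m))) (suc (suc m))

module Submission where

-- Write ⌈s/2⌉ = s ∸ ⌊s/2⌋ for the "near" target of step s and
-- s + ⌊s/2⌋ for its "far" target.  Step s either fills its near target or, if
-- that is already taken, writes at the far target; in both cases the near
-- target is assigned afterwards.  Steps 2n-1 and 2n share the near target n,
-- so at step 2n position n is already taken and the value 2n is written at
-- 2n + n = 3n.  Every later step t > 2n leaves position 3n alone: its far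
-- target t + ⌊t/2⌋ exceeds 3n, and its near target is only written when still
-- unassigned, which 3n no longer is.

open import Defs
open import Data.Nat using (ℕ; suc; zero; _*_; _≥_; _+_; _∸_; _/_; _≟_; _≤_; _<_; _≤′_; ≤′-reflexive; ≤′-step; s≤s; z≤n)
open import Data.Nat.Properties
  using (+-suc; +-comm; +-identityʳ; m+n∸n≡m; <⇒≢; ≤-refl; ≤-trans; ≤⇒≤′; ≤′⇒≤; m≤n⇒m≤1+n; +-mono-<-≤)
open import Data.Nat.DivMod using (m/n≡1+[m∸n]/n; /-monoˡ-≤)
open import Data.Maybe using (just; is-just)
open import Data.Bool using (true; false)
open import Data.Product using (∃; _,_)
open import Data.Empty using (⊥-elim)
open import Relation.Nullary using (yes; no)
open import Relation.Binary.PropositionalEquality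

half-suc-suc : ∀ m → suc (suc m) / 2 ≡ suc (m / 2)
half-suc-suc m = m/n≡1+[m∸n]/n {suc (suc m)} {2} (s≤s (s≤s z≤n))

half-double : ∀ n → (n + n) / 2 ≡ n
half-double zero    = refl
half-double (suc n) rewrite +-suc n n = trans (half-suc-suc (n + n)) (cong suc (half-double n))

half-suc-double : ∀ n → suc (n + n) / 2 ≡ n
half-suc-double zero    = refl
half-suc-double (suc n) rewrite +-suc n n =
  trans (half-suc-suc (suc (n + n))) (cong suc (half-suc-double n))

near : ℕ → ℕ
near s = s ∸ s / 2

near-odd : ∀ n → near (suc (n + n)) ≡ suc n
near-odd n = begin
  suc (n + n) ∸ suc (n + n) / 2  ≡⟨ cong (suc (n + n) ∸_) (half-suc-double n) ⟩
  suc n + n ∸ n                  ≡⟨ m+n∸n≡m (suc n) n ⟩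
  suc n                          ∎
  where open ≡-Reasoning

near-even : ∀ n → near (suc (suc (n + n))) ≡ suc n
near-even n = begin
  suc (suc (n + n)) ∸ suc (suc (n + n)) / 2  ≡⟨ cong (suc (suc (n + n)) ∸_) (half-suc-suc (n + n)) ⟩
  suc (suc (n + n)) ∸ suc ((n + n) / 2)      ≡⟨ cong (suc (n + n) ∸_) (half-double n) ⟩
  suc n + n ∸ n                              ≡⟨ m+n∸n≡m (suc n) n ⟩
  suc n                                      ∎
  where open ≡-Reasoning

far-increasing : ∀ {t n} → t ≤ n → t + t / 2 < suc n + suc n / 2
far-increasing t≤n = +-mono-<-≤ (s≤s t≤n) (/-monoˡ-≤ 2 (m≤n⇒m≤1+n t≤n))

Defined : PartialMap → ℕ → Set
Defined f q = is-just (f q) ≡ true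

assign-same : ∀ f p v → assign f p v p ≡ just v
assign-same f p v with p ≟ p
... | yes _  = refl
... | no p≢p = ⊥-elim (p≢p refl)

assign-other : ∀ f p v {q} → q ≢ p → assign f p v q ≡ f q
assign-other f p v {q} q≢p with q ≟ p
... | yes q≡p = ⊥-elim (q≢p q≡p)
... | no  _   = refl

assign-preserves : ∀ f p v {q} → Defined f q → Defined (assign f p v) q
assign-preserves f p v {q} d with q ≟ p
... | yes _ = refl
... | no  _ = d

step : PartialMap → ℕ → PartialMap
step f s = assign f (stepPos f s) s

stepPos-taken : ∀ f s → Defined f (near s) → stepPos f s ≡ s + s / 2
stepPos-taken f s taken rewrite taken = refl


step-defines-near : ∀ f s → Defined (step f s) (near s)
step-defines-near f s with is-just (f (near s)) in d
... | true  = assign-preserves f (s + s / 2) s d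
... | false = cong is-just (assign-same f (near s) s)

step-writes-far : ∀ f s → Defined f (near s) → step f s (s + s / 2) ≡ just s
step-writes-far f s taken rewrite stepPos-taken f s taken = assign-same f (s + s / 2) s

step-keeps : ∀ f s {q x} → f q ≡ just x → q < s + s / 2 → step f s q ≡ just x
step-keeps f s {q} {x} fq q<far = trans (assign-other f (stepPos f s) s q≢pos) fq
  where
  -- the far branch writes above q; the near branch only writes where f is undefined
  q≢pos : q ≢ stepPos f s
  q≢pos q≡pos with is-just (f (near s)) in d
  ... | true  = <⇒≢ q<far q≡pos
  ... | false with () ← trans (sym (cong is-just (subst (λ p → f p ≡ just x) q≡pos fq))) d

state-defines-near : ∀ m → Defined (state (suc m)) (near (suc m))
state-defines-near zero    = refl
state-defines-near (suc m) = step-defines-near (state (suc m)) (suc (suc m))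

-- A value present after step t ≥ 1 at a position not beyond the far target of
-- step t survives all later steps, whose far targets lie strictly higher.
value-persists : ∀ {m q x} → state (suc m) q ≡ just x → q ≤ suc m + suc m / 2 →
                 ∀ {n} → suc m ≤′ n → state n q ≡ just x
value-persists fixed bound (≤′-reflexive refl) = fixed
value-persists fixed bound (≤′-step {zero} (≤′-reflexive ()))
value-persists fixed bound (≤′-step {suc n} t≤n) =
  step-keeps (state (suc n)) (suc (suc n)) (value-persists fixed bound t≤n)
    (≤-trans (s≤s bound) (far-increasing (≤′⇒≤ t≤n)))

-- Step 2n writes 2n at its far target, because step 2n-1 took the common near target n.
double-step-writes-far : ∀ k → let s = suc (suc (k + k)) in state s (s + s / 2) ≡ just s
double-step-writes-far k = step-writes-far (state (suc (k + k))) (suc (suc (k + k))) near-taken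
  where
  near-taken : Defined (state (suc (k + k))) (near (suc (suc (k + k))))
  near-taken = subst (Defined (state (suc (k + k))))
                     (trans (near-odd k) (sym (near-even k)))
                     (state-defines-near (k + k))

twice : ∀ k → suc (suc (k + k)) ≡ 2 * suc k
twice k = cong suc (trans (sym (+-suc k k)) (cong (λ j → k + suc j) (sym (+-identityʳ k))))

thrice : ∀ k → let s = suc (suc (k + k)) in s + s / 2 ≡ 3 * suc k
thrice k = begin
  s + s / 2         ≡⟨ cong (s +_) (trans (half-suc-suc (k + k)) (cong suc (half-double k))) ⟩
  s + suc k         ≡⟨ +-comm s (suc k) ⟩
  suc k + s         ≡⟨ cong (suc k +_) (twice k) ⟩
  3 * suc k         ∎
  where
  open ≡-Reasoning
  s = suc (suc (k + k))

proposition1 : ∀ (k : ℕ) → ∃ λ M → ∀ m → m ≥ M →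
    state m (3 * suc k) ≡ just (2 * suc k)
proposition1 k = s , λ m s≤m →
  subst₂ (λ p v → state m p ≡ just v) (thrice k) (twice k)
    (value-persists (double-step-writes-far k) ≤-refl (≤⇒≤′ s≤m))
  where
  s = suc (suc (k + k))
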